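{- Let $G,H$ be graphs with $\gamma(H)\ge 2$. A set $D\subseteq V(G)\times V(H)$ is a minimal dominating set of $G[H]$ if and only if: (i) $p_G(D)$ is an irreducible dominating set of $G$; and (ii) for every $x\in p_G(D)$: if $x$ is totally dominated by $p_G(D)$ in $G$ then $|p_{H,x}(D)|=1$, and if $x$ is barely dominated by $p_G(D)$ in $G$ then $p_{H,x}(D)$ is a minimal dominating set of $H$.
   Context: $\gamma$ is the domination number. The lexicographic product $G[H]$ has vertex set $V(G)\times V(H)$, with $(x_1,y_1)$ adjacent to $(x_2,y_2)$ iff $x_1x_2\in E(G)$, or $x_1=x_2$ and $y_1y_2\in E(H)$. $p_G(D)=\{x: (x,y)\in D\text{ for some }y\}$, $p_{H,x}(D)=\{y:(x,y)\in D\}$. For $S\subseteq V(G)$: $x$ is totally dominated by $S$ if $N(x)\cap S\ne\emptyset$, and barely dominated by $S$ if $N[x]\cap S=\{x\}$. A dominating set $S$ is reducible if there is $u\in S$ with $S\setminus\{u\}$ dominating and $N(S)=N(S\setminus\{u\})$, and irreducible otherwise. -}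

module Defs where

open import Data.Nat using (ℕ; _≤_)
open import Data.Bool using (Bool; true; false; not; _∧_)
open import Data.Fin using (Fin)
open import Data.Fin.Subset using (∣_∣)
open import Data.Vec using (tabulate)
open import Data.List using (allFin)
open import Data.Bool.ListAction using (any)
open import Data.Product using (_×_; _,_; Σ; ∃; ∃-syntax)
open import Data.Sum using (_⊎_)
open import Relation.Nullary using (¬_; Dec; does)
open import Relation.Binary.PropositionalEquality using (_≡_; _≢_)
open import Relation.Binary.Definitions using (DecidableEquality)
open import Function.Bundles using (_⇔_)

record Graph (n : ℕ) : Set₁ where
  field
    adj    : Fin n → Fin n → Set
    adj?   : ∀ x y → Dec (adj x y)
    sym    : ∀ {x y} → adj x y → adj y x
    irrefl : ∀ {x} → ¬ adj x x
open Graph public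

VSet : Set → Set
VSet V = V → Bool

module _ {V : Set} where

  infix 4 _∈_ _∉_ _⊆_
  _∈_ : V → VSet V → Set
  x ∈ S = S x ≡ true

  _∉_ : V → VSet V → Set
  x ∉ S = ¬ (x ∈ S)

  _⊆_ : VSet V → VSet V → Set
  S ⊆ T = ∀ x → x ∈ S → x ∈ T

  _⊂_ : VSet V → VSet V → Set
  S ⊂ T = S ⊆ T × ∃[ x ] (x ∈ T × x ∉ S)

  remove : DecidableEquality V → VSet V → V → VSet V
  remove _≟_ S u x = S x ∧ not (does (x ≟ u))

  module _ (adj : V → V → Set) where

    InOpenNbhd : VSet V → V → Set
    InOpenNbhd S v = ∃[ u ] (u ∈ S × adj v u)

    Dominating : VSet V → Set
    Dominating S = ∀ v → v ∈ S ⊎ InOpenNbhd S v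

    MinimalDominating : VSet V → Set
    MinimalDominating S = Dominating S × ¬ (∃[ S' ] (S' ⊂ S × Dominating S'))

    Reducible : DecidableEquality V → VSet V → Set
    Reducible _≟_ S = ∃[ u ] (u ∈ S × Dominating (remove _≟_ S u)
                        × (∀ v → InOpenNbhd S v ⇔ InOpenNbhd (remove _≟_ S u) v))

    IrreducibleDominating : DecidableEquality V → VSet V → Set
    IrreducibleDominating _≟_ S = Dominating S × ¬ Reducible _≟_ S

    TotallyDominated : VSet V → V → Set
    TotallyDominated S x = InOpenNbhd S x

    BarelyDominated : VSet V → V → Set
    BarelyDominated S x = x ∈ S × (∀ u → (u ≡ x ⊎ adj x u) → u ∈ S → u ≡ x)

size : ∀ {n} → VSet (Fin n) → ℕ
size S = ∣ tabulate S ∣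

IsDominationNumber : ∀ {n} → Graph n → ℕ → Set
IsDominationNumber H k =
  (∃[ S ] (Dominating (adj H) S × size S ≡ k)) ×
  (∀ S → Dominating (adj H) S → k ≤ size S)

lexAdj : ∀ {m n} → Graph m → Graph n → (Fin m × Fin n) → (Fin m × Fin n) → Set
lexAdj G H (x₁ , y₁) (x₂ , y₂) = adj G x₁ x₂ ⊎ (x₁ ≡ x₂ × adj H y₁ y₂)

pG : ∀ {m n} → VSet (Fin m × Fin n) → VSet (Fin m)
pG {n = n} D x = any (λ y → D (x , y)) (allFin n)

pH : ∀ {m n} → VSet (Fin m × Fin n) → Fin m → VSet (Fin n)
pH D x y = D (x , y)

-- A set E dominates G[H] iff the fibre p_{H,x}(E) dominates H for every x outside N(p_G E),
-- and since domination is upward closed, D is minimal iff no single (x , y) can be dropped.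
-- For a minimal D: dropping the whole fibre over a vertex u witnessing reducibility, a second
-- point of the fibre over a totally dominated x, or a redundant point of the fibre over a
-- barely dominated x would each leave a dominating set. Conversely, γ(H) ≥ 2 means no fibre of
-- size 1 dominates H, so if D ∖ (x , y) still dominates then either x is totally dominated, its
-- fibre {y} disappears and every neighbourhood is kept, making p_G D reducible at x; or x is
-- barely dominated and its fibre shrinks to a smaller dominating set of H.

module Submission where

open import Defs hiding (sym)
open import Data.Nat using (ℕ; _≤_; _<_)
open import Data.Nat.Properties using (≤-trans; <-irrefl; module ≤-Reasoning)
open import Data.Fin using (Fin; _≟_; zero)
open import Data.Fin.Properties using (any?)
open import Data.Fin.Subset using (⁅_⁆; ∣_∣; _-_) renaming (_∈_ to _∈ₛ_; _⊆_ to _⊆ₛ_)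
open import Data.Fin.Subset.Properties
  using (∣⁅x⁆∣≡1; x∈⁅x⁆; x∈⁅y⁆⇒x≡y; ⊆-antisym; p⊆q⇒∣p∣≤∣q∣; ∣p∣≤n; x∈p⇒∣p-x∣<∣p∣; x∈p∧x≢y⇒x∈p-y)
open import Data.Vec using (tabulate)
open import Data.Vec.Properties using (lookup∘tabulate; []=⇒lookup; lookup⇒[]=)
open import Data.Bool using (true; false) renaming (_≟_ to _≟ᵇ_)
open import Data.Bool.Properties using (T-≡)
open import Data.List using (allFin)
open import Data.List.Membership.Propositional using (lose)
open import Data.List.Membership.Propositional.Properties using (∈-allFin)
open import Data.List.Relation.Unary.Any using (satisfied)
open import Data.List.Relation.Unary.Any.Properties using (any⁺; any⁻)
open import Data.Product using (_×_; ∃-syntax; _,_; proj₁; proj₂; map₂)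
open import Data.Product.Properties using (≡-dec)
open import Data.Sum using (_⊎_; inj₁; inj₂; [_,_]′)
open import Data.Empty using (⊥-elim)
open import Function using (_∘_)
open import Function.Bundles using (_⇔_; mk⇔; Equivalence)
open import Relation.Nullary using (¬_; Dec; yes; no; contradiction)
open import Relation.Nullary.Decidable using (_×-dec_)
open import Relation.Binary.Definitions using (DecidableEquality)
open import Relation.Binary.PropositionalEquality using (_≡_; _≢_; refl; sym; trans; cong; subst)

module _ {V : Set} (adj : V → V → Set) where

  InOpenNbhd-mono : ∀ {S T v} → S ⊆ T → InOpenNbhd adj S v → InOpenNbhd adj T v
  InOpenNbhd-mono S⊆T (u , u∈S , v~u) = u , S⊆T u u∈S , v~u

  dominating-⊆ : ∀ {S T} → S ⊆ T → Dominating adj S → Dominating adj T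
  dominating-⊆ S⊆T domS v with domS v
  ... | inj₁ v∈S = inj₁ (S⊆T v v∈S)
  ... | inj₂ v∈NS = inj₂ (InOpenNbhd-mono S⊆T v∈NS)

  dominating-nonempty : ∀ {S} → V → Dominating adj S → ∃[ u ] u ∈ S
  dominating-nonempty v domS with domS v
  ... | inj₁ v∈S = v , v∈S
  ... | inj₂ (u , u∈S , _) = u , u∈S

  ¬totally⇒barely : ∀ {S x} → x ∈ S → ¬ TotallyDominated adj S x → BarelyDominated adj S x
  ¬totally⇒barely {S} {x} x∈S ¬t = x∈S , only-x
    where
    only-x : ∀ u → (u ≡ x ⊎ adj x u) → u ∈ S → u ≡ x
    only-x u (inj₁ u≡x) _ = u≡x
    only-x u (inj₂ x~u) u∈S = contradiction (u , u∈S , x~u) ¬t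

module _ {V : Set} (_≟ᵛ_ : DecidableEquality V) where

  ∈-remove⁺ : ∀ {S u x} → x ∈ S → x ≢ u → x ∈ remove _≟ᵛ_ S u
  ∈-remove⁺ {S} {u} {x} x∈S x≢u with x ≟ᵛ u
  ... | yes x≡u = contradiction x≡u x≢u
  ... | no _ rewrite x∈S = refl

  ∈-remove⁻ : ∀ {S u x} → x ∈ remove _≟ᵛ_ S u → x ∈ S × x ≢ u
  ∈-remove⁻ {S} {u} {x} x∈S-u with S x | x ≟ᵛ u | x∈S-u
  ... | true | no x≢u | _ = refl , x≢u
  ... | true | yes _ | ()
  ... | false | _ | ()

  remove-⊆ : ∀ {S u} → remove _≟ᵛ_ S u ⊆ S
  remove-⊆ {S} {u} _ = proj₁ ∘ ∈-remove⁻ {S} {u}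

  ⊆-remove : ∀ {S S' u} → S' ⊆ S → u ∉ S' → S' ⊆ remove _≟ᵛ_ S u
  ⊆-remove {S} {S'} S'⊆S u∉S' x x∈S' =
    ∈-remove⁺ {S} (S'⊆S x x∈S') (λ x≡u → u∉S' (subst (_∈ S') x≡u x∈S'))

  module _ (adj : V → V → Set) where

    -- Domination is upward closed, so minimality only has to be tested on single removals.
    minimal⇒¬dominating-remove : ∀ {S u} → MinimalDominating adj S → u ∈ S →
                                 ¬ Dominating adj (remove _≟ᵛ_ S u)
    minimal⇒¬dominating-remove {S} {u} (_ , minS) u∈S domS-u =
      minS (_ , (remove-⊆ , u , u∈S , λ u∈S-u → proj₂ (∈-remove⁻ {S} u∈S-u) refl) , domS-u)

    ¬dominating-remove⇒minimal : ∀ {S} → Dominating adj S →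
                                 (∀ u → u ∈ S → ¬ Dominating adj (remove _≟ᵛ_ S u)) →
                                 MinimalDominating adj S
    ¬dominating-remove⇒minimal domS undominating =
      domS , λ { (S' , (S'⊆S , u , u∈S , u∉S') , domS') →
                 undominating u u∈S (dominating-⊆ adj (⊆-remove S'⊆S u∉S') domS') }

module _ {n : ℕ} {S : VSet (Fin n)} where

  ∈-tabulate⁺ : ∀ {x} → x ∈ S → x ∈ₛ tabulate S
  ∈-tabulate⁺ {x} x∈S = lookup⇒[]= x (tabulate S) (trans (lookup∘tabulate S x) x∈S)

  ∈-tabulate⁻ : ∀ {x} → x ∈ₛ tabulate S → x ∈ S
  ∈-tabulate⁻ {x} x∈p = trans (sym (lookup∘tabulate S x)) ([]=⇒lookup x∈p)

  size≡1 : ∀ {y} → y ∈ S → (∀ z → z ∈ S → z ≡ y) → size S ≡ 1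
  size≡1 {y} y∈S unique = trans (cong ∣_∣ tabulate≡⁅y⁆) (∣⁅x⁆∣≡1 y)
    where
    tabulate≡⁅y⁆ : tabulate S ≡ ⁅ y ⁆
    tabulate≡⁅y⁆ = ⊆-antisym
      (λ z∈p → subst (_∈ₛ ⁅ y ⁆) (sym (unique _ (∈-tabulate⁻ z∈p))) (x∈⁅x⁆ y))
      (λ z∈⁅y⁆ → subst (_∈ₛ tabulate S) (sym (x∈⁅y⁆⇒x≡y y z∈⁅y⁆)) (∈-tabulate⁺ y∈S))

  size≡1⇒≡ : ∀ {y z} → size S ≡ 1 → y ∈ S → z ∈ S → z ≡ y
  size≡1⇒≡ {y} {z} ∣S∣≡1 y∈S z∈S with z ≟ y
  ... | yes z≡y = z≡y
  ... | no z≢y = contradiction 1<1 (<-irrefl refl)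
    where
    open ≤-Reasoning
    p = tabulate S
    ⁅z⁆⊆p-y : ⁅ z ⁆ ⊆ₛ p - y
    ⁅z⁆⊆p-y w∈⁅z⁆ = subst (_∈ₛ p - y) (sym (x∈⁅y⁆⇒x≡y z w∈⁅z⁆))
                         (x∈p∧x≢y⇒x∈p-y (∈-tabulate⁺ z∈S) z≢y)
    1<1 : 1 < 1
    1<1 = begin-strict
      1          ≡⟨ sym (∣⁅x⁆∣≡1 z) ⟩
      ∣ ⁅ z ⁆ ∣  ≤⟨ p⊆q⇒∣p∣≤∣q∣ ⁅z⁆⊆p-y ⟩
      ∣ p - y ∣  <⟨ x∈p⇒∣p-x∣<∣p∣ (∈-tabulate⁺ y∈S) ⟩
      ∣ p ∣      ≡⟨ ∣S∣≡1 ⟩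
      1          ∎

γ≥2⇒vertex : ∀ {n} {H : Graph n} {k} → IsDominationNumber H k → 2 ≤ k → Fin n
γ≥2⇒vertex {ℕ.zero} ((S , _ , ∣S∣≡k) , _) 2≤k =
  contradiction (≤-trans 2≤k (subst (_≤ 0) ∣S∣≡k (∣p∣≤n (tabulate S)))) λ ()
γ≥2⇒vertex {ℕ.suc _} _ _ = zero

γ≥2⇒size≢1 : ∀ {n} {H : Graph n} {k} → IsDominationNumber H k → 2 ≤ k →
             ∀ {S} → Dominating (adj H) S → size S ≢ 1
γ≥2⇒size≢1 {k = k} γ 2≤k {S} domS ∣S∣≡1 =
  <-irrefl refl (≤-trans 2≤k (subst (k ≤_) ∣S∣≡1 (proj₂ γ S domS)))

_≟²_ : ∀ {m n} → DecidableEquality (Fin m × Fin n)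
_≟²_ = ≡-dec _≟_ _≟_

infixl 6 _∖_
_∖_ : ∀ {m n} → VSet (Fin m × Fin n) → Fin m × Fin n → VSet (Fin m × Fin n)
D ∖ p = remove _≟²_ D p

private variable
  m n : ℕ
  D E : VSet (Fin m × Fin n)
  x : Fin m
  y y' : Fin n

∈-pG⁺ : (D : VSet (Fin m × Fin n)) → (x , y) ∈ D → x ∈ pG D
∈-pG⁺ {y = y} _ xy∈D =
  Equivalence.to T-≡ (any⁺ _ (lose (∈-allFin y) (Equivalence.from T-≡ xy∈D)))

∈-pG⁻ : (D : VSet (Fin m × Fin n)) → x ∈ pG D → ∃[ y ] (x , y) ∈ D
∈-pG⁻ {n = n} _ x∈pD =
  map₂ (Equivalence.to T-≡) (satisfied (any⁻ _ (allFin n) (Equivalence.from T-≡ x∈pD)))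

pG-mono : E ⊆ D → pG E ⊆ pG D
pG-mono {E = E} {D = D} E⊆D x x∈pE =
  let (y , xy∈E) = ∈-pG⁻ E x∈pE in ∈-pG⁺ D (E⊆D (x , y) xy∈E)

∈-pG-∖ : ∀ {a} → a ≢ x → a ∈ pG D → a ∈ pG (D ∖ (x , y))
∈-pG-∖ {x = x} {D = D} {y = y} a≢x a∈pD =
  let (b , ab∈D) = ∈-pG⁻ D a∈pD
  in ∈-pG⁺ (D ∖ (x , y)) (∈-remove⁺ _≟²_ {D} ab∈D (a≢x ∘ cong proj₁))

pG-∖ : (x , y') ∈ D → y' ≢ y → pG D ⊆ pG (D ∖ (x , y))
pG-∖ {x = x} {D = D} {y = y} xy'∈D y'≢y a a∈pD = by-cases (a ≟ x)
  where
  by-cases : Dec (a ≡ x) → a ∈ pG (D ∖ (x , y))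
  by-cases (yes refl) = ∈-pG⁺ (D ∖ (x , y)) (∈-remove⁺ _≟²_ {D} xy'∈D (y'≢y ∘ cong proj₂))
  by-cases (no a≢x)   = ∈-pG-∖ {D = D} a≢x a∈pD

∉-pG-∖ : size (pH D x) ≡ 1 → (x , y) ∈ D → x ∉ pG (D ∖ (x , y))
∉-pG-∖ {D = D} {x = x} {y = y} ∣Dx∣≡1 xy∈D x∈pD' =
  let (y' , xy'∈D') = ∈-pG⁻ (D ∖ (x , y)) x∈pD'
      (xy'∈D , xy'≢xy) = ∈-remove⁻ _≟²_ {D} xy'∈D'
  in xy'≢xy (cong (x ,_) (size≡1⇒≡ ∣Dx∣≡1 xy∈D xy'∈D))

pH-∖⁺ : remove _≟_ (pH D x) y ⊆ pH (D ∖ (x , y)) x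
pH-∖⁺ {D = D} {x = x} w w∈ =
  let (xw∈D , w≢y) = ∈-remove⁻ _≟_ {pH D x} w∈
  in ∈-remove⁺ _≟²_ {D} xw∈D (w≢y ∘ cong proj₂)

pH-∖⁻ : pH (D ∖ (x , y)) x ⊆ remove _≟_ (pH D x) y
pH-∖⁻ {D = D} {x = x} w w∈ =
  let (xw∈D , xw≢xy) = ∈-remove⁻ _≟²_ {D} w∈
  in ∈-remove⁺ _≟_ {pH D x} xw∈D (xw≢xy ∘ cong (x ,_))

pH-∖-≢ : ∀ {z} → z ≢ x → pH D z ⊆ pH (D ∖ (x , y)) z
pH-∖-≢ {D = D} z≢x w zw∈D = ∈-remove⁺ _≟²_ {D} zw∈D (z≢x ∘ cong proj₁)

InOpenNbhd? : ∀ {m} (G : Graph m) (S : VSet (Fin m)) x → Dec (InOpenNbhd (adj G) S x)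
InOpenNbhd? G S x = any? (λ u → (S u ≟ᵇ true) ×-dec adj? G x u)

barely⇒¬totally : ∀ {m} (G : Graph m) {S x} →
                  BarelyDominated (adj G) S x → ¬ TotallyDominated (adj G) S x
barely⇒¬totally G (_ , only-x) (u , u∈S , x~u) =
  irrefl G (subst (adj G _) (only-x u (inj₂ x~u) u∈S) x~u)

module Lexicographic {m n} (G : Graph m) (H : Graph n) where

  L : Fin m × Fin n → Fin m × Fin n → Set
  L = lexAdj G H

  dominating⇒pH-dominating : ∀ {E x} → Dominating L E →
                             ¬ InOpenNbhd (adj G) (pG E) x → Dominating (adj H) (pH E x)
  dominating⇒pH-dominating {E} {x} domE ¬t w with domE (x , w)
  ... | inj₁ xw∈E = inj₁ xw∈E
  ... | inj₂ ((x' , _) , x'w'∈E , inj₁ x~x') = contradiction (x' , ∈-pG⁺ E x'w'∈E , x~x') ¬t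
  ... | inj₂ ((_ , w') , xw'∈E , inj₂ (refl , w~w')) = inj₂ (w' , xw'∈E , w~w')

  pH-dominating⇒dominating : ∀ {E} →
    (∀ x → ¬ InOpenNbhd (adj G) (pG E) x → Dominating (adj H) (pH E x)) → Dominating L E
  pH-dominating⇒dominating {E} fibres (x , w) with InOpenNbhd? G (pG E) x
  ... | yes (x' , x'∈pE , x~x') =
        let (w' , x'w'∈E) = ∈-pG⁻ E x'∈pE in inj₂ ((x' , w') , x'w'∈E , inj₁ x~x')
  ... | no ¬t with fibres x ¬t w
  ...   | inj₁ xw∈E = inj₁ xw∈E
  ...   | inj₂ (w' , xw'∈E , w~w') = inj₂ ((x , w') , xw'∈E , inj₂ (refl , w~w'))

  pG-dominating : ∀ {E} → Fin n → Dominating L E → Dominating (adj G) (pG E)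
  pG-dominating {E} w₀ domE x with InOpenNbhd? G (pG E) x
  ... | yes t = inj₂ t
  ... | no ¬t =
        let (w , xw∈E) = dominating-nonempty (adj H) w₀ (dominating⇒pH-dominating domE ¬t)
        in inj₁ (∈-pG⁺ E xw∈E)

  dominating-∖ : ∀ {D x y} → Dominating L D →
    (∀ z → InOpenNbhd (adj G) (pG D) z → InOpenNbhd (adj G) (pG (D ∖ (x , y))) z) →
    (¬ InOpenNbhd (adj G) (pG D) x → Dominating (adj H) (pH (D ∖ (x , y)) x)) →
    Dominating L (D ∖ (x , y))
  dominating-∖ {D} {x} {y} domD N⊆N' fibre-x =
    pH-dominating⇒dominating λ z ¬t' → fibre z (z ≟ x) (¬t' ∘ N⊆N' z)
    where
    fibre : ∀ z → Dec (z ≡ x) → ¬ InOpenNbhd (adj G) (pG D) z →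
            Dominating (adj H) (pH (D ∖ (x , y)) z)
    fibre z (yes refl) ¬t = fibre-x ¬t
    fibre z (no z≢x)   ¬t =
      dominating-⊆ (adj H) (pH-∖-≢ {D = D} z≢x) (dominating⇒pH-dominating domD ¬t)

  FibreCondition : VSet (Fin m × Fin n) → Set
  FibreCondition D = ∀ x → x ∈ pG D →
    (TotallyDominated (adj G) (pG D) x → size (pH D x) ≡ 1) ×
    (BarelyDominated (adj G) (pG D) x → MinimalDominating (adj H) (pH D x))

  module Characterisation (w₀ : Fin n) (size≢1 : ∀ {S} → Dominating (adj H) S → size S ≢ 1) where

    minimal⇒irreducible : ∀ {D} → MinimalDominating L D → IrreducibleDominating (adj G) _≟_ (pG D)
    minimal⇒irreducible {D} minD@(domD , _) = pG-dominating w₀ domD , ¬reducible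
      where
      ¬reducible : ¬ Reducible (adj G) _≟_ (pG D)
      ¬reducible (u , u∈pD , domR , N⇔NR) =
        let (y , uy∈D) = ∈-pG⁻ D u∈pD
        in minimal⇒¬dominating-remove _≟²_ L minD uy∈D
             (dominating-∖ domD (N⊆N' y) (contradiction u∈N))
        where
        N⊆N' : ∀ y z → InOpenNbhd (adj G) (pG D) z → InOpenNbhd (adj G) (pG (D ∖ (u , y))) z
        N⊆N' y z t = InOpenNbhd-mono (adj G)
          (λ a a∈R → let (a∈pD , a≢u) = ∈-remove⁻ _≟_ {pG D} a∈R in ∈-pG-∖ {D = D} a≢u a∈pD)
          (Equivalence.to (N⇔NR z) t)
        u∈N : InOpenNbhd (adj G) (pG D) u
        u∈N with domR u
        ... | inj₁ u∈R = contradiction refl (proj₂ (∈-remove⁻ _≟_ {pG D} u∈R))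
        ... | inj₂ t = InOpenNbhd-mono (adj G) (remove-⊆ _≟_) t

    totally⇒size-pH≡1 : ∀ {D x y} → MinimalDominating L D →
                        TotallyDominated (adj G) (pG D) x → (x , y) ∈ D → size (pH D x) ≡ 1
    totally⇒size-pH≡1 {D} {x} {y} minD@(domD , _) t xy∈D = size≡1 xy∈D only-y
      where
      only-y : ∀ z → z ∈ pH D x → z ≡ y
      only-y z xz∈D with z ≟ y
      ... | yes z≡y = z≡y
      ... | no z≢y = ⊥-elim (minimal⇒¬dominating-remove _≟²_ L minD xz∈D
        (dominating-∖ domD (λ _ → InOpenNbhd-mono (adj G) (pG-∖ xy∈D (z≢y ∘ sym)))
                           (contradiction t)))

    barely⇒pH-minimal : ∀ {D x} → MinimalDominating L D →
                        BarelyDominated (adj G) (pG D) x → MinimalDominating (adj H) (pH D x)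
    barely⇒pH-minimal {D} {x} minD@(domD , _) barely =
      ¬dominating-remove⇒minimal _≟_ (adj H)
        (dominating⇒pH-dominating domD (barely⇒¬totally G barely)) undominating
      where
      undominating : ∀ y → y ∈ pH D x → ¬ Dominating (adj H) (remove _≟_ (pH D x) y)
      undominating y xy∈D domDx-y =
        let (y' , y'∈) = dominating-nonempty (adj H) w₀ domDx-y
            (xy'∈D , y'≢y) = ∈-remove⁻ _≟_ {pH D x} y'∈
        in minimal⇒¬dominating-remove _≟²_ L minD xy∈D
             (dominating-∖ domD (λ _ → InOpenNbhd-mono (adj G) (pG-∖ xy'∈D y'≢y))
                                (λ _ → dominating-⊆ (adj H) (pH-∖⁺ {D = D}) domDx-y))

    minimal⇒fibreCondition : ∀ {D} → MinimalDominating L D → FibreCondition D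
    minimal⇒fibreCondition {D} minD x x∈pD =
      (λ t → totally⇒size-pH≡1 minD t (proj₂ (∈-pG⁻ D x∈pD))) , barely⇒pH-minimal minD

    -- A vertex of N(p_G D) outside N(p_G E) would carry a dominating fibre of size 1.
    dominating-⊆⇒InOpenNbhd-pG : ∀ {D E v} → FibreCondition D → E ⊆ D → Dominating L E →
                                 InOpenNbhd (adj G) (pG D) v → InOpenNbhd (adj G) (pG E) v
    dominating-⊆⇒InOpenNbhd-pG {D} {E} {v} cond E⊆D domE t with InOpenNbhd? G (pG E) v
    ... | yes t' = t'
    ... | no ¬t' = contradiction (proj₁ (cond v v∈pD) t) (size≢1 domDv)
      where
      domDv : Dominating (adj H) (pH D v)
      domDv = dominating-⊆ (adj H) (λ w → E⊆D (v , w)) (dominating⇒pH-dominating domE ¬t')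
      v∈pD : v ∈ pG D
      v∈pD = let (w , vw∈D) = dominating-nonempty (adj H) w₀ domDv in ∈-pG⁺ D vw∈D

    dominating-∖⇒reducible : ∀ {D x y} → FibreCondition D → TotallyDominated (adj G) (pG D) x →
                             (x , y) ∈ D → Dominating L (D ∖ (x , y)) → Reducible (adj G) _≟_ (pG D)
    dominating-∖⇒reducible {D} {x} {y} cond t xy∈D domD' =
      x , x∈pD , dominating-⊆ (adj G) pD'⊆R (pG-dominating w₀ domD') , N⇔NR
      where
      x∈pD : x ∈ pG D
      x∈pD = ∈-pG⁺ D xy∈D
      pD'⊆R : pG (D ∖ (x , y)) ⊆ remove _≟_ (pG D) x
      pD'⊆R = ⊆-remove _≟_ (pG-mono (remove-⊆ _≟²_ {D}))
                           (∉-pG-∖ {D = D} (proj₁ (cond x x∈pD) t) xy∈D)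
      N⇔NR : ∀ v → InOpenNbhd (adj G) (pG D) v ⇔ InOpenNbhd (adj G) (remove _≟_ (pG D) x) v
      N⇔NR v = mk⇔
        (InOpenNbhd-mono (adj G) pD'⊆R ∘ dominating-⊆⇒InOpenNbhd-pG cond (remove-⊆ _≟²_) domD')
        (InOpenNbhd-mono (adj G) (remove-⊆ _≟_))

    irreducible⇒minimal : ∀ {D} → IrreducibleDominating (adj G) _≟_ (pG D) → FibreCondition D →
                          MinimalDominating L D
    irreducible⇒minimal {D} (domG , ¬reducible) cond =
      ¬dominating-remove⇒minimal _≟²_ L domD undominating
      where
      pH-minimal : ∀ {x} → x ∈ pG D → ¬ TotallyDominated (adj G) (pG D) x →
                   MinimalDominating (adj H) (pH D x)
      pH-minimal x∈pD ¬t = proj₂ (cond _ x∈pD) (¬totally⇒barely (adj G) x∈pD ¬t)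
      domD : Dominating L D
      domD = pH-dominating⇒dominating λ x ¬t →
        [ (λ x∈pD → proj₁ (pH-minimal x∈pD ¬t)) , (λ t → contradiction t ¬t) ]′ (domG x)
      undominating : ∀ p → p ∈ D → ¬ Dominating L (D ∖ p)
      undominating (x , y) xy∈D domD' with InOpenNbhd? G (pG D) x
      ... | yes t = ¬reducible (dominating-∖⇒reducible cond t xy∈D domD')
      ... | no ¬t = minimal⇒¬dominating-remove _≟_ (adj H) (pH-minimal (∈-pG⁺ D xy∈D) ¬t) xy∈D
        (dominating-⊆ (adj H) (pH-∖⁻ {D = D}) (dominating⇒pH-dominating domD' ¬t'))
        where
        ¬t' : ¬ InOpenNbhd (adj G) (pG (D ∖ (x , y))) x
        ¬t' = ¬t ∘ InOpenNbhd-mono (adj G) (pG-mono (remove-⊆ _≟²_ {D}))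

theorem8 : ∀ {m n} (G : Graph m) (H : Graph n) →
    (∃[ k ] (IsDominationNumber H k × 2 ≤ k)) →
    (D : VSet (Fin m × Fin n)) →
    MinimalDominating (lexAdj G H) D ⇔
      (IrreducibleDominating (adj G) _≟_ (pG D) ×
       (∀ x → x ∈ pG D →
         (TotallyDominated (adj G) (pG D) x → size (pH D x) ≡ 1) ×
         (BarelyDominated (adj G) (pG D) x → MinimalDominating (adj H) (pH D x))))
theorem8 G H (k , γ , 2≤k) D =
  mk⇔ (λ minD → minimal⇒irreducible minD , minimal⇒fibreCondition minD)
      (λ (irreducible , fibres) → irreducible⇒minimal irreducible fibres)
  where
  open Lexicographic.Characterisation G H (γ≥2⇒vertex {H = H} γ 2≤k) (γ≥2⇒size≢1 {H = H} γ 2≤k)
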